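{- Let $n\ge1$, $X=\{1,2,\dots,n\}$ and $R=\{\{i,i+1,\dots,j\}: 1\le i\le j\le n\}$ (the discrete intervals), and $H=(X,R)$. Then $\rho(H)=\lfloor\log_2 n\rfloor+1$.
   Context: Online hitting set problem on a hypergraph $H=(X,R)$: an adversary presents a finite sequence $\sigma=(r_1,\dots,r_s)$ of ranges from $R$ one at a time; a deterministic online algorithm maintains a chain $C_1\subseteq C_2\subseteq\cdots\subseteq X$ such that $C_i\cap r_j\neq\emptyset$ for all $j\le i$ (points may be added but never removed). Let $\mathrm{ALG}(\sigma)$ be the final set and $\mathrm{OPT}(\sigma)$ a minimum-cardinality subset of $X$ intersecting every range of $\sigma$. The competitive ratio of $\mathrm{ALG}$ is $\max_\sigma |\mathrm{ALG}(\sigma)|/|\mathrm{OPT}(\sigma)|$, and $\rho(H)$ is the minimum competitive ratio over all deterministic online algorithms. -}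

module Defs where

open import Data.Nat using (ℕ; _≤_; _*_)
open import Data.Fin using (Fin)
import Data.Fin as F
open import Data.Fin.Subset using (Subset; _∈_; _⊆_; ∣_∣)
open import Data.List using (List; []; _∷_; _++_; [_])
open import Data.List.Relation.Unary.All using (All)
open import Data.Empty using (⊥)
open import Data.Unit using (⊤)
open import Data.Product using (Σ; _×_; ∃; ∃-syntax)

-- Discrete interval {lo, ..., hi} ⊆ X = Fin n (points 1..n are 0..n-1), lo ≤ hi.
record Interval (n : ℕ) : Set where
  constructor [_⋯_∣_]
  field
    lo : Fin n
    hi : Fin n
    lo≤hi : lo F.≤ hi

open Interval public

_∈ᵢ_ : {n : ℕ} → Fin n → Interval n → Set
x ∈ᵢ r = (lo r F.≤ x) × (x F.≤ hi r)

Hits : {n : ℕ} → Subset n → Interval n → Set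
Hits S r = ∃[ x ] (x ∈ S × x ∈ᵢ r)

HittingSet : {n : ℕ} → Subset n → List (Interval n) → Set
HittingSet S σ = All (Hits S) σ

NonEmpty : {A : Set} → List A → Set
NonEmpty [] = ⊥
NonEmpty (_ ∷ _) = ⊤

-- A deterministic online algorithm: maps the sequence of ranges presented so
-- far (in chronological order) to its current set; the set after each step
-- must hit every range presented so far, and sets only grow.
record OnlineAlg (n : ℕ) : Set where
  field
    current : List (Interval n) → Subset n
    valid   : ∀ σ → HittingSet (current σ) σ
    monotone : ∀ σ r → current σ ⊆ current (σ ++ [ r ])

open OnlineAlg public

-- |ALG(σ)| ≤ c · |OPT(σ)| for every nonempty σ (stated against every hitting
-- set S, equivalently against a minimum one): competitive ratio ≤ c.
RatioAtMost : {n : ℕ} → OnlineAlg n → ℕ → Set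
RatioAtMost {n} A c =
  (σ : List (Interval n)) → NonEmpty σ →
  (S : Subset n) → HittingSet S σ → ∣ current A σ ∣ ≤ c * ∣ S ∣

-- Some nonempty σ with |ALG(σ)| ≥ c · |OPT(σ)| (witnessed by a hitting set S,
-- necessarily |S| ≥ |OPT(σ)|): competitive ratio ≥ c.
RatioAtLeast : {n : ℕ} → OnlineAlg n → ℕ → Set
RatioAtLeast {n} A c =
  Σ (List (Interval n)) λ σ → NonEmpty σ ×
  Σ (Subset n) λ S → HittingSet S σ × (c * ∣ S ∣ ≤ ∣ current A σ ∣)

-- ρ(H) = c for H = ([n], discrete intervals): some algorithm achieves ratio ≤ c
-- and every algorithm has ratio ≥ c.
OptimalRatioIs : ℕ → ℕ → Set
OptimalRatioIs n c = (Σ (OnlineAlg n) λ A → RatioAtMost A c)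
                   × ((A : OnlineAlg n) → RatioAtLeast A c)

-- Upper bound: arrange the points 0, …, n − 1 as a perfect binary search tree of height
-- ⌊log₂ n⌋ + 1 and answer each interval with its node closest to the root. That node lies
-- on the search path of every point of the interval, so each point of a hitting set S
-- accounts for at most ⌊log₂ n⌋ + 1 chosen nodes.
-- Lower bound: the adversary presents a block of length 2^k. If the algorithm holds only
-- m ≤ k points of it, then since (m + 1)·2^(k−m) ≤ 2^k some sub-block of length 2^(k−m)
-- is still empty; recursing inside it forces k − m + 1 further points, k + 1 in all.
-- The presented intervals are nested, so one point hits all of them.
module Submission where

open import Data.Bool using (Bool; true; false; if_then_else_)
open import Data.Empty using (⊥-elim)
open import Data.Fin as Fin using (Fin; toℕ; fromℕ<)
open import Data.Fin.Properties using (toℕ<n; toℕ-fromℕ<)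
open import Data.Fin.Subset using (Subset; ∣_∣; ⁅_⁆; _∪_; _⊆_) renaming (_∈_ to _∈ₛ_; ⊥ to ∅)
open import Data.Fin.Subset.Properties using (x∈⁅x⁆; x∈⁅y⁆⇒x≡y; ∣⁅x⁆∣≡1; x∈p∪q⁺; x∈p∪q⁻; ∉⊥)
open import Data.List using (List; []; _∷_; _++_; [_]; length; map; concatMap)
open import Data.List.Properties using (length-++; length-map; ++-assoc; ++-identityʳ)
open import Data.List.Membership.Propositional using (_∈_)
open import Data.List.Membership.Propositional.Properties
  using (∈-∃++; ∈-++⁻; ∈-++⁺ˡ; ∈-++⁺ʳ; ∈-map⁺; ∈-concat⁺′)
open import Data.List.Relation.Unary.All as All using (All; []; _∷_)
open import Data.List.Relation.Unary.All.Properties using (++⁻ʳ)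
open import Data.List.Relation.Unary.Any as Any using (Any; here; there)
open import Data.List.Relation.Unary.Any.Properties using (++⁺ˡ)
open import Data.Nat
open import Data.Nat.Induction using (<-rec)
open import Data.Nat.Logarithm using (⌊log₂_⌋; ⌊log₂⌋-mono-≤; ⌊log₂[2^n]⌋≡n)
open import Data.Nat.Logarithm.Core using (⌊log2⌋)
open import Data.Nat.Properties
open import Data.Nat.Tactic.RingSolver using (solve-∀)
open import Data.Product using (∃-syntax; _×_; _,_; proj₁; proj₂)
open import Data.Sum using (inj₁; inj₂)
open import Data.Unit using (tt)
open import Data.Vec as Vec using ()
open import Induction.WellFounded using (acc)
open import Relation.Binary.PropositionalEquality hiding ([_])
open import Relation.Nullary using (Dec; yes; no)

open import Defs

n<2^n : ∀ n → n < 2 ^ n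
n<2^n zero    = z<s
n<2^n (suc n) = begin-strict
  suc n                ≤⟨ n<2^n n ⟩
  2 ^ n                ≡⟨ +-identityʳ (2 ^ n) ⟨
  2 ^ n + 0            <⟨ +-monoʳ-< (2 ^ n) (m^n>0 2 n) ⟩
  2 ^ n + 2 ^ n        ≡⟨ cong (2 ^ n +_) (+-identityʳ (2 ^ n)) ⟨
  2 ^ suc n            ∎
  where open ≤-Reasoning

[1+m]*2^j≤2^[m+j] : ∀ m j → suc m * 2 ^ j ≤ 2 ^ (m + j)
[1+m]*2^j≤2^[m+j] m j = begin
  suc m * 2 ^ j   ≤⟨ *-monoˡ-≤ (2 ^ j) (n<2^n m) ⟩
  2 ^ m * 2 ^ j   ≡⟨ ^-distribˡ-+-* 2 m j ⟨
  2 ^ (m + j)     ∎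
  where open ≤-Reasoning

2^⌊log₂n⌋≤n : ∀ n → 1 ≤ n → 2 ^ ⌊log₂ n ⌋ ≤ n
2^⌊log₂n⌋≤n (suc n) _ = 2^⌊log2⌋≤ n
  where
  -- ⌊log₂_⌋ is ⌊log2⌋ on <-wellFounded, so recursing on the accessibility proof unfolds it.
  2*⌊n/2⌋≤n : ∀ n → 2 * ⌊ n /2⌋ ≤ n
  2*⌊n/2⌋≤n n = begin
    ⌊ n /2⌋ + (⌊ n /2⌋ + 0)  ≡⟨ cong (⌊ n /2⌋ +_) (+-identityʳ _) ⟩
    ⌊ n /2⌋ + ⌊ n /2⌋        ≤⟨ +-monoʳ-≤ ⌊ n /2⌋ (⌊n/2⌋≤⌈n/2⌉ n) ⟩
    ⌊ n /2⌋ + ⌈ n /2⌉        ≡⟨ ⌊n/2⌋+⌈n/2⌉≡n n ⟩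
    n                        ∎
    where open ≤-Reasoning
  2^⌊log2⌋≤ : ∀ n {rec} → 2 ^ ⌊log2⌋ (suc n) rec ≤ suc n
  2^⌊log2⌋≤ zero            = s≤s z≤n
  2^⌊log2⌋≤ (suc n) {acc _} = begin
    2 * 2 ^ ⌊log2⌋ (suc ⌊ n /2⌋) _  ≤⟨ *-monoʳ-≤ 2 (2^⌊log2⌋≤ ⌊ n /2⌋) ⟩
    2 * suc ⌊ n /2⌋                 ≡⟨ *-suc 2 ⌊ n /2⌋ ⟩
    2 + 2 * ⌊ n /2⌋                 ≤⟨ +-monoʳ-≤ 2 (2*⌊n/2⌋≤n n) ⟩
    2 + n                           ∎
    where open ≤-Reasoning

n<2^[⌊log₂n⌋+1] : ∀ n → n < 2 ^ (⌊log₂ n ⌋ + 1)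
n<2^[⌊log₂n⌋+1] n with n <? 2 ^ (⌊log₂ n ⌋ + 1)
... | yes n<2^ = n<2^
... | no n≮2^  = ⊥-elim (m+1+n≰m ⌊log₂ n ⌋ (begin
  ⌊log₂ n ⌋ + 1                      ≡⟨ ⌊log₂[2^n]⌋≡n (⌊log₂ n ⌋ + 1) ⟨
  ⌊log₂ 2 ^ (⌊log₂ n ⌋ + 1) ⌋        ≤⟨ ⌊log₂⌋-mono-≤ (≮⇒≥ n≮2^) ⟩
  ⌊log₂ n ⌋                          ∎))
  where open ≤-Reasoning

count : (ℕ → Bool) → ℕ → ℕ → ℕ
count f a zero    = 0
count f a (suc l) = if f a then suc (count f (suc a) l) else count f (suc a) l

count-suc : ∀ f a l → count f (suc a) l ≡ count (λ y → f (suc y)) a l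
count-suc f a zero    = refl
count-suc f a (suc l) rewrite count-suc f (suc a) l = refl

count-++ : ∀ f a l₁ l₂ → count f a (l₁ + l₂) ≡ count f a l₁ + count f (a + l₁) l₂
count-++ f a zero     l₂ = cong (λ b → count f b l₂) (sym (+-identityʳ a))
count-++ f a (suc l₁) l₂ rewrite +-suc a l₁ with f a
... | true  = cong suc (count-++ f (suc a) l₁ l₂)
... | false = count-++ f (suc a) l₁ l₂

count-monoʳ : ∀ f a {l l′} → l ≤ l′ → count f a l ≤ count f a l′
count-monoʳ f a {l} {l′} l≤l′ = begin
  count f a l                                    ≤⟨ m≤m+n _ _ ⟩
  count f a l + count f (a + l) (l′ ∸ l)         ≡⟨ count-++ f a l (l′ ∸ l) ⟨
  count f a (l + (l′ ∸ l))                       ≡⟨ cong (count f a) (m+[n∸m]≡n l≤l′) ⟩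
  count f a l′                                   ∎
  where open ≤-Reasoning

count-mono : ∀ {f g} → (∀ y → f y ≡ true → g y ≡ true) → ∀ a l → count f a l ≤ count g a l
count-mono f⇒g a zero = z≤n
count-mono {f} {g} f⇒g a (suc l) with f a in fa | g a in ga
... | true  | true  = s≤s (count-mono f⇒g (suc a) l)
... | true  | false with () ← trans (sym (f⇒g a fa)) ga
... | false | true  = m≤n⇒m≤1+n (count-mono f⇒g (suc a) l)
... | false | false = count-mono f⇒g (suc a) l

0<count : ∀ f {a l y} → f y ≡ true → a ≤ y → y < a + l → 0 < count f a l
0<count f {a} {zero}  fy a≤y y<a+0 = ⊥-elim (<⇒≱ (subst (_ <_) (+-identityʳ a) y<a+0) a≤y)
0<count f {a} {suc l} {y} fy a≤y y<a+l with f a in fa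
... | true  = z<s
... | false = 0<count f fy (≤∧≢⇒< a≤y a≢y) (subst (y <_) (+-suc a l) y<a+l)
  where
  a≢y : a ≢ y
  a≢y refl with () ← trans (sym fa) fy

count-≤-length : ∀ f a l xs → (∀ y → a ≤ y → f y ≡ true → y ∈ xs) → count f a l ≤ length xs
count-≤-length f a zero    xs covers = z≤n
count-≤-length f a (suc l) xs covers with f a in fa
... | false = count-≤-length f (suc a) l xs (λ y a<y → covers y (<⇒≤ a<y))
... | true with ys , zs , refl ← ∈-∃++ (covers a ≤-refl fa) = begin
  suc (count f (suc a) l)       ≤⟨ s≤s (count-≤-length f (suc a) l (ys ++ zs) covers′) ⟩
  suc (length (ys ++ zs))       ≡⟨ cong suc (length-++ ys) ⟩
  suc (length ys + length zs)   ≡⟨ +-suc (length ys) (length zs) ⟨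
  length ys + length (a ∷ zs)   ≡⟨ length-++ ys ⟨
  length (ys ++ a ∷ zs)         ∎
  where
  open ≤-Reasoning
  covers′ : ∀ y → suc a ≤ y → f y ≡ true → y ∈ ys ++ zs
  covers′ y a<y fy with ∈-++⁻ ys (covers y (<⇒≤ a<y) fy)
  ... | inj₁ y∈ys          = ∈-++⁺ˡ y∈ys
  ... | inj₂ (here refl)   = ⊥-elim (<-irrefl refl a<y)
  ... | inj₂ (there y∈zs)  = ∈-++⁺ʳ ys y∈zs

count-fill-gap : ∀ {f g} → (∀ y → f y ≡ true → g y ≡ true) →
                 ∀ a d {b L} → d + b ≤ L → count f (a + d) b ≡ 0 →
                 count f a L + count g (a + d) b ≤ count g a L
count-fill-gap {f} {g} f⇒g a d {b} {L} d+b≤L gap = begin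
  count f a L + count g (a + d) b                                ≡⟨ cong (_+ count g (a + d) b) (split f) ⟩
  count f a d + count f (a + d) b + count f (a + d + b) e
    + count g (a + d) b                                          ≡⟨ cong (λ z → count f a d + z + count f (a + d + b) e + count g (a + d) b) gap ⟩
  count f a d + 0 + count f (a + d + b) e + count g (a + d) b    ≤⟨ +-monoˡ-≤ _ (+-mono-≤ (+-monoˡ-≤ 0 (mono a d)) (mono (a + d + b) e)) ⟩
  count g a d + 0 + count g (a + d + b) e + count g (a + d) b    ≡⟨ rearrange (count g a d) (count g (a + d + b) e) (count g (a + d) b) ⟩
  count g a d + count g (a + d) b + count g (a + d + b) e        ≡⟨ split g ⟨
  count g a L                                                    ∎
  where
  open ≤-Reasoning
  e = L ∸ (d + b)
  mono = count-mono f⇒g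
  split : ∀ h → count h a L ≡ count h a d + count h (a + d) b + count h (a + d + b) e
  split h = begin-equality
    count h a L                                                ≡⟨ cong (count h a) (m+[n∸m]≡n d+b≤L) ⟨
    count h a (d + b + e)                                      ≡⟨ count-++ h a (d + b) e ⟩
    count h a (d + b) + count h (a + (d + b)) e                ≡⟨ cong₂ _+_ (count-++ h a d b) (cong (λ z → count h z e) (sym (+-assoc a d b))) ⟩
    count h a d + count h (a + d) b + count h (a + d + b) e    ∎
  rearrange : ∀ x y z → x + 0 + y + z ≡ x + z + y
  rearrange = solve-∀

-- If the first block of length b holds a point, the other at most m − 1 points lie in
-- the rest, of length at least m · b.
empty-block : ∀ f m b a l → count f a l ≤ m → suc m * b ≤ l →
              ∃[ d ] d + b ≤ l × count f (a + d) b ≡ 0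
empty-block f m b a l few long with count f a b in first
... | zero = 0 , m+n≤o⇒m≤o b long , trans (cong (λ z → count f z b) (+-identityʳ a)) first
... | suc _ with m
...   | zero = ⊥-elim (<⇒≱ (subst (0 <_) (sym first) z<s) (≤-trans (count-monoʳ f a (m+n≤o⇒m≤o b long)) few))
...   | suc m′ = shift (empty-block f m′ b (a + b) (l ∸ b) few′ long′)
  where
  l≡b+rest : b + (l ∸ b) ≡ l
  l≡b+rest = m+[n∸m]≡n (m+n≤o⇒m≤o b long)
  few′ : count f (a + b) (l ∸ b) ≤ m′
  few′ = s≤s⁻¹ (begin
    suc (count f (a + b) (l ∸ b))             ≤⟨ +-monoˡ-≤ _ (subst (1 ≤_) (sym first) (s≤s z≤n)) ⟩
    count f a b + count f (a + b) (l ∸ b)     ≡⟨ count-++ f a b (l ∸ b) ⟨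
    count f a (b + (l ∸ b))                   ≡⟨ cong (count f a) l≡b+rest ⟩
    count f a l                               ≤⟨ few ⟩
    suc m′                                    ∎)
    where open ≤-Reasoning
  long′ : suc m′ * b ≤ l ∸ b
  long′ = m+n≤o⇒m≤o∸n (suc m′ * b) (subst (_≤ l) (+-comm b _) long)
  shift : ∃[ d ] d + b ≤ l ∸ b × count f (a + b + d) b ≡ 0 →
          ∃[ d ] d + b ≤ l × count f (a + d) b ≡ 0
  shift (d , fits , empty) =
    b + d ,
    subst₂ _≤_ (sym (+-assoc b d b)) l≡b+rest (+-monoʳ-≤ b fits) ,
    trans (cong (λ z → count f z b) (sym (+-assoc a b d))) empty

member : ∀ {n} → Subset n → ℕ → Bool
member Vec.[]       _       = false
member (b Vec.∷ p) zero    = b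
member (b Vec.∷ p) (suc y) = member p y

member⁺ : ∀ {n} {x : Fin n} {p} → x ∈ₛ p → member p (toℕ x) ≡ true
member⁺ Vec.here        = refl
member⁺ (Vec.there x∈p) = member⁺ x∈p

member⁻ : ∀ {n} (p : Subset n) y → member p y ≡ true → ∃[ x ] toℕ x ≡ y × x ∈ₛ p
member⁻ (true Vec.∷ p) zero    _ = Fin.zero , refl , Vec.here
member⁻ (b Vec.∷ p)    (suc y) m with x , refl , x∈p ← member⁻ p y m = Fin.suc x , refl , Vec.there x∈p

member-mono : ∀ {n} {p q : Subset n} → p ⊆ q → ∀ y → member p y ≡ true → member q y ≡ true
member-mono {p = p} p⊆q y m with x , refl , x∈p ← member⁻ p y m = member⁺ (p⊆q x∈p)

∣p∣≡count : ∀ {n} (p : Subset n) → ∣ p ∣ ≡ count (member p) 0 n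
∣p∣≡count Vec.[]                    = refl
∣p∣≡count {suc n} (true Vec.∷ p)  = cong suc (trans (∣p∣≡count p) (sym (count-suc (member (true Vec.∷ p)) 0 n)))
∣p∣≡count {suc n} (false Vec.∷ p) = trans (∣p∣≡count p) (sym (count-suc (member (false Vec.∷ p)) 0 n))

∣p∣≤length : ∀ {n} (p : Subset n) xs → (∀ x → x ∈ₛ p → toℕ x ∈ xs) → ∣ p ∣ ≤ length xs
∣p∣≤length {n} p xs covers = begin
  ∣ p ∣                   ≡⟨ ∣p∣≡count p ⟩
  count (member p) 0 n    ≤⟨ count-≤-length (member p) 0 n xs covers′ ⟩
  length xs               ∎
  where
  open ≤-Reasoning
  covers′ : ∀ y → 0 ≤ y → member p y ≡ true → y ∈ xs
  covers′ y _ m with x , refl , x∈p ← member⁻ p y m = covers x x∈p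

elements : ∀ {n} → Subset n → List (Fin n)
elements Vec.[]            = []
elements (true Vec.∷ p)  = Fin.zero ∷ map Fin.suc (elements p)
elements (false Vec.∷ p) = map Fin.suc (elements p)

∈-elements : ∀ {n} {x : Fin n} {p} → x ∈ₛ p → x ∈ elements p
∈-elements {p = true Vec.∷ p}  Vec.here        = here refl
∈-elements {p = true Vec.∷ p}  (Vec.there x∈p) = there (∈-map⁺ Fin.suc (∈-elements x∈p))
∈-elements {p = false Vec.∷ p} (Vec.there x∈p) = ∈-map⁺ Fin.suc (∈-elements x∈p)

length-elements : ∀ {n} (p : Subset n) → length (elements p) ≡ ∣ p ∣
length-elements Vec.[]            = refl
length-elements (true Vec.∷ p)  = cong suc (trans (length-map Fin.suc (elements p)) (length-elements p))
length-elements (false Vec.∷ p) = trans (length-map Fin.suc (elements p)) (length-elements p)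

length-concatMap-≤ : ∀ {A B : Set} (f : A → List B) {c} → (∀ x → length (f x) ≤ c) →
                     ∀ xs → length (concatMap f xs) ≤ c * length xs
length-concatMap-≤ f bounded []       = z≤n
length-concatMap-≤ f {c} bounded (x ∷ xs) = begin
  length (f x ++ concatMap f xs)          ≡⟨ length-++ (f x) ⟩
  length (f x) + length (concatMap f xs)  ≤⟨ +-mono-≤ (bounded x) (length-concatMap-≤ f bounded xs) ⟩
  c + c * length xs                       ≡⟨ *-suc c (length xs) ⟨
  c * length (x ∷ xs)                     ∎
  where open ≤-Reasoning

nodes : ℕ → ℕ
nodes zero    = 0
nodes (suc d) = nodes d + suc (nodes d)

suc-nodes : ∀ d → suc (nodes d) ≡ 2 ^ d
suc-nodes zero    = refl
suc-nodes (suc d) = begin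
  suc (nodes d) + suc (nodes d)  ≡⟨ cong₂ _+_ (suc-nodes d) (trans (suc-nodes d) (sym (+-identityʳ (2 ^ d)))) ⟩
  2 ^ d + (2 ^ d + 0)            ∎
  where open ≡-Reasoning

-- The perfect binary search tree of height suc d on [a, a + nodes (suc d)) has root
-- root d a; its subtrees of height d lie on [a, root d a) and on [suc (root d a), …).
root : ℕ → ℕ → ℕ
root d a = a + nodes d

+-nodes-suc : ∀ a d → a + nodes (suc d) ≡ suc (root d a) + nodes d
+-nodes-suc a d = begin
  a + (nodes d + suc (nodes d))  ≡⟨ cong (a +_) (+-suc (nodes d) (nodes d)) ⟩
  a + suc (nodes d + nodes d)    ≡⟨ +-suc a _ ⟩
  suc (a + (nodes d + nodes d))  ≡⟨ cong suc (+-assoc a (nodes d) (nodes d)) ⟨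
  suc (a + nodes d + nodes d)    ∎
  where open ≡-Reasoning

searchPath : ℕ → ℕ → ℕ → List ℕ
searchPath zero    a p = []
searchPath (suc d) a p with p <? root d a | root d a <? p
... | yes _ | _     = root d a ∷ searchPath d a p
... | no _  | yes _ = root d a ∷ searchPath d (suc (root d a)) p
... | no _  | no _  = root d a ∷ []

highestNodeIn : ℕ → ℕ → ℕ → ℕ → ℕ
highestNodeIn zero    a lo hi = lo  -- the empty tree: excluded by the hypotheses below
highestNodeIn (suc d) a lo hi with hi <? root d a | root d a <? lo
... | yes _ | _     = highestNodeIn d a lo hi
... | no _  | yes _ = highestNodeIn d (suc (root d a)) lo hi
... | no _  | no _  = root d a

length-searchPath : ∀ d a p → length (searchPath d a p) ≤ d
length-searchPath zero    a p = z≤n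
length-searchPath (suc d) a p with p <? root d a | root d a <? p
... | yes _ | _     = s≤s (length-searchPath d a p)
... | no _  | yes _ = s≤s (length-searchPath d (suc (root d a)) p)
... | no _  | no _  = s≤s z≤n

highestNodeIn-∈ : ∀ d a {lo hi} → a ≤ lo → lo ≤ hi → hi < root d a →
                  lo ≤ highestNodeIn d a lo hi × highestNodeIn d a lo hi ≤ hi
highestNodeIn-∈ zero a a≤lo lo≤hi hi<a+0 =
  ⊥-elim (<⇒≱ (subst (_ <_) (+-identityʳ a) hi<a+0) (≤-trans a≤lo lo≤hi))
highestNodeIn-∈ (suc d) a {lo} {hi} a≤lo lo≤hi hi<end with hi <? root d a | root d a <? lo
... | yes hi<r | _      = highestNodeIn-∈ d a a≤lo lo≤hi hi<r
... | no _     | yes r<lo = highestNodeIn-∈ d (suc (root d a)) r<lo lo≤hi (subst (hi <_) (+-nodes-suc a d) hi<end)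
... | no hi≮r  | no r≮lo  = ≮⇒≥ r≮lo , ≮⇒≥ hi≮r

highestNodeIn-∈-searchPath : ∀ d a {lo hi p} → a ≤ lo → hi < root d a → lo ≤ p → p ≤ hi →
                             highestNodeIn d a lo hi ∈ searchPath d a p
highestNodeIn-∈-searchPath zero a a≤lo hi<a+0 lo≤p p≤hi =
  ⊥-elim (<⇒≱ (subst (_ <_) (+-identityʳ a) hi<a+0) (≤-trans a≤lo (≤-trans lo≤p p≤hi)))
highestNodeIn-∈-searchPath (suc d) a {lo} {hi} {p} a≤lo hi<end lo≤p p≤hi
  with hi <? root d a | root d a <? lo | p <? root d a | root d a <? p
... | yes hi<r | _        | yes _   | _       = there (highestNodeIn-∈-searchPath d a a≤lo hi<r lo≤p p≤hi)
... | yes hi<r | _        | no p≮r  | _       = ⊥-elim (p≮r (≤-<-trans p≤hi hi<r))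
... | no _     | yes r<lo | yes p<r | _       = ⊥-elim (<-asym p<r (<-≤-trans r<lo lo≤p))
... | no _     | yes r<lo | no _    | yes _   =
  there (highestNodeIn-∈-searchPath d (suc (root d a)) r<lo (subst (hi <_) (+-nodes-suc a d) hi<end) lo≤p p≤hi)
... | no _     | yes r<lo | no _    | no r≮p  = ⊥-elim (r≮p (<-≤-trans r<lo lo≤p))
... | no _     | no _     | yes _   | _       = here refl
... | no _     | no _     | no _    | yes _   = here refl
... | no _     | no _     | no _    | no _    = here refl

module TreeAlgorithm (n : ℕ) where

  height : ℕ
  height = ⌊log₂ n ⌋ + 1

  n≤nodes : n ≤ nodes height
  n≤nodes = s≤s⁻¹ (subst (n <_) (sym (suc-nodes height)) (n<2^[⌊log₂n⌋+1] n))

  choiceℕ : Interval n → ℕ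
  choiceℕ r = highestNodeIn height 0 (toℕ (lo r)) (toℕ (hi r))

  choiceℕ-∈ : ∀ r → toℕ (lo r) ≤ choiceℕ r × choiceℕ r ≤ toℕ (hi r)
  choiceℕ-∈ r = highestNodeIn-∈ height 0 z≤n (lo≤hi r) (<-≤-trans (toℕ<n (hi r)) n≤nodes)

  choice : Interval n → Fin n
  choice r = fromℕ< (≤-<-trans (proj₂ (choiceℕ-∈ r)) (toℕ<n (hi r)))

  toℕ-choice : ∀ r → toℕ (choice r) ≡ choiceℕ r
  toℕ-choice r = toℕ-fromℕ< _

  choice-∈ : ∀ r → choice r ∈ᵢ r
  choice-∈ r with lo≤choice , choice≤hi ← choiceℕ-∈ r rewrite toℕ-choice r = lo≤choice , choice≤hi

  choice-∈-searchPath : ∀ {r x} → x ∈ᵢ r → toℕ (choice r) ∈ searchPath height 0 (toℕ x)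
  choice-∈-searchPath {r} (lo≤x , x≤hi) rewrite toℕ-choice r =
    highestNodeIn-∈-searchPath height 0 z≤n (<-≤-trans (toℕ<n (hi r)) n≤nodes) lo≤x x≤hi

  chosen : List (Interval n) → Subset n
  chosen []      = ∅
  chosen (r ∷ σ) = ⁅ choice r ⁆ ∪ chosen σ

  ∈-chosen⁺ : ∀ {x} σ → Any (λ r → x ≡ choice r) σ → x ∈ₛ chosen σ
  ∈-chosen⁺ (r ∷ σ) (here refl) = x∈p∪q⁺ (inj₁ (x∈⁅x⁆ (choice r)))
  ∈-chosen⁺ (r ∷ σ) (there x∈σ) = x∈p∪q⁺ (inj₂ (∈-chosen⁺ σ x∈σ))

  ∈-chosen⁻ : ∀ {x} σ → x ∈ₛ chosen σ → Any (λ r → x ≡ choice r) σ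
  ∈-chosen⁻ []      x∈∅ = ⊥-elim (∉⊥ x∈∅)
  ∈-chosen⁻ (r ∷ σ) x∈  with x∈p∪q⁻ ⁅ choice r ⁆ (chosen σ) x∈
  ... | inj₁ x∈⁅c⁆ = here (x∈⁅y⁆⇒x≡y (choice r) x∈⁅c⁆)
  ... | inj₂ x∈σ   = there (∈-chosen⁻ σ x∈σ)

  algorithm : OnlineAlg n
  algorithm = record
    { current  = chosen
    ; valid    = λ σ → All.tabulate λ {r} r∈σ →
                   choice r , ∈-chosen⁺ σ (Any.map (cong choice) r∈σ) , choice-∈ r
    ; monotone = λ σ r x∈ → ∈-chosen⁺ (σ ++ [ r ]) (++⁺ˡ (∈-chosen⁻ σ x∈))
    }

  ratioAtMost : RatioAtMost algorithm height
  ratioAtMost σ _ S S-hits = begin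
    ∣ chosen σ ∣                                          ≤⟨ ∣p∣≤length (chosen σ) _ covered ⟩
    length (concatMap path (elements S))                  ≤⟨ length-concatMap-≤ path (λ p → length-searchPath height 0 (toℕ p)) (elements S) ⟩
    height * length (elements S)                          ≡⟨ cong (height *_) (length-elements S) ⟩
    height * ∣ S ∣                                        ∎
    where
    open ≤-Reasoning
    path : Fin n → List ℕ
    path p = searchPath height 0 (toℕ p)
    covered : ∀ x → x ∈ₛ chosen σ → toℕ x ∈ concatMap path (elements S)
    covered x x∈ = on-path (All.lookupAny S-hits x∈σ)
      where
      x∈σ = ∈-chosen⁻ σ x∈
      r = Any.lookup x∈σ
      on-path : Hits S r × x ≡ choice r → toℕ x ∈ concatMap path (elements S)
      on-path ((p , p∈S , p∈r) , x≡choice) =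
        subst (λ z → toℕ z ∈ _) (sym x≡choice)
          (∈-concat⁺′ (choice-∈-searchPath {r} p∈r) (∈-map⁺ path (∈-elements p∈S)))

module _ {n : ℕ} where

  span : (a l : ℕ) → 0 < l → a + l ≤ n → Interval n
  span a (suc l) _ a+l≤n =
    [ fromℕ< a<n ⋯ fromℕ< last<n ∣ subst₂ _≤_ (sym (toℕ-fromℕ< a<n)) (sym (toℕ-fromℕ< last<n)) (m≤m+n a l) ]
    where
    last<n : a + l < n
    last<n = subst (_≤ n) (+-suc a l) a+l≤n
    a<n : a < n
    a<n = ≤-<-trans (m≤m+n a l) last<n

  ∈-span : ∀ a l {0<l a+l≤n} {x : Fin n} → a ≤ toℕ x → toℕ x < a + l → x ∈ᵢ span a l 0<l a+l≤n
  ∈-span a (suc l) {x = x} a≤x x<a+l =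
    subst (_≤ _) (sym (toℕ-fromℕ< _)) a≤x ,
    subst (toℕ x ≤_) (sym (toℕ-fromℕ< _)) (s≤s⁻¹ (subst (toℕ x <_) (+-suc a l) x<a+l))

  span-∋ : ∀ a l {0<l a+l≤n} {x : Fin n} → x ∈ᵢ span a l 0<l a+l≤n → a ≤ toℕ x × toℕ x < a + l
  span-∋ a (suc l) {x = x} (a≤x , x≤last) =
    subst (_≤ _) (toℕ-fromℕ< _) a≤x ,
    subst (toℕ x <_) (sym (+-suc a l)) (s≤s (subst (toℕ x ≤_) (toℕ-fromℕ< _) x≤last))

  span-mono : ∀ a d b l {0<b 0<l a+d+b≤n a+l≤n} {x : Fin n} → d + b ≤ l →
              x ∈ᵢ span (a + d) b 0<b a+d+b≤n → x ∈ᵢ span a l 0<l a+l≤n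
  span-mono a d b l d+b≤l x∈ with a+d≤x , x<a+d+b ← span-∋ (a + d) b x∈ =
    ∈-span a l (≤-trans (m≤m+n a d) a+d≤x)
           (<-≤-trans x<a+d+b (subst (_≤ a + l) (sym (+-assoc a d b)) (+-monoʳ-≤ a d+b≤l)))

module Adversary {n : ℕ} (A : OnlineAlg n) where

  current-++ : ∀ σ ρ → current A σ ⊆ current A (σ ++ ρ)
  current-++ σ []      = subst (λ τ → current A σ ⊆ current A τ) (sym (++-identityʳ σ)) (λ x∈ → x∈)
  current-++ σ (r ∷ ρ) x∈ =
    subst (λ τ → _ ∈ₛ current A τ) (++-assoc σ [ r ] ρ) (current-++ (σ ++ [ r ]) ρ (monotone A σ r x∈))

  pointsIn : List (Interval n) → ℕ → ℕ → ℕ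
  pointsIn σ = count (member (current A σ))

  pointsIn-fill-gap : ∀ σ ρ a d {b l} → d + b ≤ l → pointsIn σ (a + d) b ≡ 0 →
                      pointsIn σ a l + pointsIn (σ ++ ρ) (a + d) b ≤ pointsIn (σ ++ ρ) a l
  pointsIn-fill-gap σ ρ = count-fill-gap (member-mono (current-++ σ ρ))

  block : (a k : ℕ) → a + 2 ^ k ≤ n → Interval n
  block a k = span a (2 ^ k) (m^n>0 2 k)

  record Forced (σ : List (Interval n)) (a k : ℕ) (a+2^k≤n : a + 2 ^ k ≤ n) : Set where
    field
      τ      : List (Interval n)
      point  : Fin n
      stabs  : All (point ∈ᵢ_) (block a k a+2^k≤n ∷ τ)
      forced : suc k ≤ pointsIn (σ ++ block a k a+2^k≤n ∷ τ) a (2 ^ k)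

  answer : ∀ σ I → Hits (current A (σ ++ [ I ])) I
  answer σ I = All.head (++⁻ʳ σ (valid A (σ ++ [ I ])))

  0<pointsIn-block : ∀ σ a k a+2^k≤n → 0 < pointsIn (σ ++ [ block a k a+2^k≤n ]) a (2 ^ k)
  0<pointsIn-block σ a k a+2^k≤n with y , y∈C , y∈I ← answer σ (block a k a+2^k≤n) =
    0<count _ (member⁺ y∈C) (proj₁ (span-∋ a (2 ^ k) y∈I)) (proj₂ (span-∋ a (2 ^ k) y∈I))

  force-step : ∀ k → (∀ {j} → j < k → ∀ σ a a+2^j≤n → Forced σ a j a+2^j≤n) →
               ∀ σ a a+2^k≤n → Forced σ a k a+2^k≤n
  force-step k force-below σ a a+2^k≤n = respond (suc k ≤? m)
    where
    I = block a k a+2^k≤n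
    σ₁ = σ ++ [ I ]
    m = pointsIn σ₁ a (2 ^ k)
    respond : Dec (suc k ≤ m) → Forced σ a k a+2^k≤n
    respond (yes enough) with y , _ , y∈I ← answer σ I =
      record { τ = [] ; point = y ; stabs = y∈I ∷ [] ; forced = enough }
    respond (no few) = descend (empty-block (member (current A σ₁)) m (2 ^ j) a (2 ^ k) ≤-refl long)
      where
      m≤k : m ≤ k
      m≤k = s≤s⁻¹ (≰⇒> few)
      j = k ∸ m
      m+j≡k : m + j ≡ k
      m+j≡k = m+[n∸m]≡n m≤k
      long : suc m * 2 ^ j ≤ 2 ^ k
      long = subst (λ e → suc m * 2 ^ j ≤ 2 ^ e) m+j≡k ([1+m]*2^j≤2^[m+j] m j)
      descend : ∃[ d ] d + 2 ^ j ≤ 2 ^ k × pointsIn σ₁ (a + d) (2 ^ j) ≡ 0 → Forced σ a k a+2^k≤n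
      descend (d , fits , empty) = record
        { τ = I′ ∷ τ
        ; point = point
        ; stabs = span-mono a d (2 ^ j) (2 ^ k) fits (All.head stabs) ∷ stabs
        ; forced = begin
            suc k                              ≡⟨ cong suc m+j≡k ⟨
            suc (m + j)                        ≡⟨ +-suc m j ⟨
            m + suc j                          ≤⟨ +-monoʳ-≤ m forced ⟩
            m + pointsIn σ₂ (a + d) (2 ^ j)    ≤⟨ pointsIn-fill-gap σ₁ (I′ ∷ τ) a d fits empty ⟩
            pointsIn σ₂ a (2 ^ k)              ≡⟨ cong (λ ρ → pointsIn ρ a (2 ^ k)) (++-assoc σ [ I ] (I′ ∷ τ)) ⟩
            pointsIn (σ ++ I ∷ I′ ∷ τ) a (2 ^ k) ∎
        }
        where
        a+d+2^j≤n : a + d + 2 ^ j ≤ n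
        a+d+2^j≤n = ≤-trans (≤-reflexive (+-assoc a d _)) (≤-trans (+-monoʳ-≤ a fits) a+2^k≤n)
        I′ = block (a + d) j a+d+2^j≤n
        open Forced (force-below (∸-monoʳ-< (0<pointsIn-block σ a k a+2^k≤n) m≤k) σ₁ (a + d) a+d+2^j≤n)
        σ₂ = σ₁ ++ I′ ∷ τ
        open ≤-Reasoning

  force : ∀ k σ a a+2^k≤n → Forced σ a k a+2^k≤n
  force = <-rec _ force-step

  ratioAtLeast : 1 ≤ n → RatioAtLeast A (⌊log₂ n ⌋ + 1)
  ratioAtLeast 1≤n = I ∷ τ , tt , ⁅ point ⁆ , All.map (λ x∈r → point , x∈⁅x⁆ point , x∈r) stabs , bound
    where
    k = ⌊log₂ n ⌋
    2^k≤n : 2 ^ k ≤ n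
    2^k≤n = 2^⌊log₂n⌋≤n n 1≤n
    I = block 0 k 2^k≤n
    open Forced (force k [] 0 2^k≤n)
    bound : (k + 1) * ∣ ⁅ point ⁆ ∣ ≤ ∣ current A (I ∷ τ) ∣
    bound = begin
      (k + 1) * ∣ ⁅ point ⁆ ∣    ≡⟨ cong ((k + 1) *_) (∣⁅x⁆∣≡1 point) ⟩
      (k + 1) * 1                ≡⟨ trans (*-identityʳ (k + 1)) (+-comm k 1) ⟩
      suc k                      ≤⟨ forced ⟩
      pointsIn (I ∷ τ) 0 (2 ^ k) ≤⟨ count-monoʳ _ 0 2^k≤n ⟩
      pointsIn (I ∷ τ) 0 n       ≡⟨ ∣p∣≡count (current A (I ∷ τ)) ⟨
      ∣ current A (I ∷ τ) ∣      ∎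
      where open ≤-Reasoning

proposition2 : (n : ℕ) → 1 ≤ n → OptimalRatioIs n (⌊log₂ n ⌋ + 1)
proposition2 n 1≤n = (algorithm , ratioAtMost) , λ A → Adversary.ratioAtLeast A 1≤n
  where open TreeAlgorithm n
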